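{- The rule $R_6$ (elimination of the double cut) is derivable in $ALFA_{Io}+\{I_{\vee p}\}$: for all graphs $A,B$, $A[[B]]\vdash AB$.
   Context: Graphs: the empty graph $\emptyset$ and propositional letters are graphs; if $G,H$ are graphs then so are the juxtaposition $GH$, the cut $[G]$ ($G$ inside a solid closed curve), the implication graph $\langle G\Rightarrow H\rangle$ (a solid closed curve containing $G$ and a dotted closed curve containing $H$), and the disjunction graph $\langle G\vee H\rangle$ (a solid closed curve containing two semi-dotted closed curves, one containing $G$ and one containing $H$; $\langle G\vee H\rangle=\langle H\vee G\rangle$). Juxtaposition is associative and commutative with unit $\emptyset$; $[\,]$ is the empty cut. Rules are schemata with $A,B,C$ arbitrary (possibly empty) graphs, applied to the whole graph on the sheet. The system $ALFA_{Io}$ has first-degree rules $MP_i: A\langle A\Rightarrow B\rangle\vdash B$; $I_\vee: A\vdash\langle A\vee B\rangle$; $R_2: AB\vdash A$; $I_{p3}:\langle A\vee B\rangle\vdash\langle[A]\Rightarrow B\rangle$; $I_{p2}: [AB]\vdash\langle A\Rightarrow[B]\rangle$; $E_p:\langle A\Rightarrow B\rangle\vdash[A[B]]$; and second-degree rules $R_{8i}$: if $AB\vdash C$ then $A\vdash\langle B\Rightarrow C\rangle$; $R_0$: if $A\vdash B$ and $A\vdash C$ then $A\vdash BC$; $E_\vee$: if $A\vdash C$ and $B\vdash C$ then $\langle A\vee B\rangle\vdash C$. The system $ALFA_{Io}+\{I_{\vee p}\}$ is $ALFA_{Io}$ with the additional first-degree rule $I_{\vee p}: [[A][B]]\vdash\langle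 A\vee B\rangle$. Derivability in a system is the least transitive relation on graphs containing all instances of its first-degree rules and closed under its second-degree rules. -}

module Defs where

open import Data.Nat using (ℕ)

data Graph : Set where
  ∅      : Graph
  letter : ℕ → Graph
  _·_    : Graph → Graph → Graph
  cut    : Graph → Graph
  ⟨_⇒_⟩  : Graph → Graph → Graph
  ⟨_∨_⟩  : Graph → Graph → Graph

infixl 6 _·_

data _≈_ : Graph → Graph → Set where
  ≈-refl  : ∀ {G} → G ≈ G
  ≈-sym   : ∀ {G H} → G ≈ H → H ≈ G
  ≈-trans : ∀ {G H K} → G ≈ H → H ≈ K → G ≈ K
  ·-assoc : ∀ {G H K} → (G · H) · K ≈ G · (H · K)
  ·-comm  : ∀ {G H} → G · H ≈ H · G
  ·-unit  : ∀ {G} → ∅ · G ≈ G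
  ∨-comm  : ∀ {G H} → ⟨ G ∨ H ⟩ ≈ ⟨ H ∨ G ⟩
  ·-cong  : ∀ {G G' H H'} → G ≈ G' → H ≈ H' → G · H ≈ G' · H'
  cut-cong : ∀ {G G'} → G ≈ G' → cut G ≈ cut G'
  ⇒-cong  : ∀ {G G' H H'} → G ≈ G' → H ≈ H' → ⟨ G ⇒ H ⟩ ≈ ⟨ G' ⇒ H' ⟩
  ∨-cong  : ∀ {G G' H H'} → G ≈ G' → H ≈ H' → ⟨ G ∨ H ⟩ ≈ ⟨ G' ∨ H' ⟩

infix 4 _≈_ _⊢_

data _⊢_ : Graph → Graph → Set where
  same  : ∀ {G H} → G ≈ H → G ⊢ H
  trans : ∀ {G H K} → G ⊢ H → H ⊢ K → G ⊢ K
  MPi   : ∀ {A B} → A · ⟨ A ⇒ B ⟩ ⊢ B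
  I∨    : ∀ {A B} → A ⊢ ⟨ A ∨ B ⟩
  R2    : ∀ {A B} → A · B ⊢ A
  Ip3   : ∀ {A B} → ⟨ A ∨ B ⟩ ⊢ ⟨ cut A ⇒ B ⟩
  Ip2   : ∀ {A B} → cut (A · B) ⊢ ⟨ A ⇒ cut B ⟩
  Ep    : ∀ {A B} → ⟨ A ⇒ B ⟩ ⊢ cut (A · cut B)
  I∨p   : ∀ {A B} → cut (cut A · cut B) ⊢ ⟨ A ∨ B ⟩
  R8i   : ∀ {A B C} → A · B ⊢ C → A ⊢ ⟨ B ⇒ C ⟩
  R0    : ∀ {A B C} → A ⊢ B → A ⊢ C → A ⊢ B · C
  E∨    : ∀ {A B C} → A ⊢ C → B ⊢ C → ⟨ A ∨ B ⟩ ⊢ C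

-- The double cut [[B]] is rewritten, through I_p2 and E_p, as [[B][[ ]]],
-- which I_∨p turns into the disjunction ⟨B ∨ [ ]⟩. Both disjuncts yield B:
-- the empty cut [ ] does so ex falso, since [[ ]] is a theorem and
-- [ ] ⊢ ⟨[[ ]] ⇒ B⟩ by I_∨ followed by I_p3.
module Submission where

open import Defs

⊢-refl : ∀ {G} → G ⊢ G
⊢-refl = same ≈-refl

⊢-fromEmpty : ∀ {G H} → ∅ ⊢ G → H ⊢ G
⊢-fromEmpty ∅⊢G = trans (same (≈-sym ·-unit)) (trans R2 ∅⊢G)

·-monoʳ-⊢ : ∀ {A B C} → B ⊢ C → A · B ⊢ A · C
·-monoʳ-⊢ B⊢C = R0 R2 (trans (same ·-comm) (trans R2 B⊢C))

∅⊢doubleEmptyCut : ∅ ⊢ cut (cut ∅)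
∅⊢doubleEmptyCut =
  trans (R8i {A = ∅} {B = ∅} (same ·-unit)) (trans Ep (same (cut-cong ·-unit)))

emptyCut⊢ : ∀ {B} → cut ∅ ⊢ B
emptyCut⊢ {B} =
  trans (R0 (⊢-fromEmpty ∅⊢doubleEmptyCut) (trans I∨ Ip3))
        (MPi {A = cut (cut ∅)} {B = B})

doubleCut⊢ : ∀ {B} → cut (cut B) ⊢ B
doubleCut⊢ {B} =
  trans (same (cut-cong (≈-trans (≈-sym ·-unit) ·-comm)))
        (trans (Ip2 {A = cut B} {B = ∅})
               (trans Ep (trans I∨p (E∨ ⊢-refl emptyCut⊢))))

mainTheorem19 : (A B : Graph) → A · cut (cut B) ⊢ A · B
mainTheorem19 A B = ·-monoʳ-⊢ doubleCut⊢
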